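{- Let $n>2$ and let $G$ be the star $K_{1,n-1}$. Then $M(G)=2\mathbb{N}=\{2,4,6,\dots\}$, so $\mathrm{pm}(G)=2$, and $\mathrm{pi}(G)=1$ if $n$ is odd and $\mathrm{pi}(G)=2$ if $n$ is even.
   Context: For a positive integer $m$, $mK_n$ denotes the $m$-fold complete multigraph on $n$ vertices, with exactly $m$ parallel edges between each pair of distinct vertices. For a graph $G$ on $n$ vertices, $mK_n$ "can be partitioned into copies of $G$" if there is a finite list of graphs $G_1,\dots,G_l$, each on the same $n$-element vertex set and each isomorphic to $G$, such that every pair of distinct vertices is an edge of exactly $m$ of the $G_i$. Define $M(G)=\{m\in\mathbb{Z}_{>0} : mK_n \text{ can be partitioned into copies of } G\}$. The partition modulus $\mathrm{pm}(G)$ is the greatest common divisor of $M(G)$. For $G$ with $n$ vertices, $e\ge1$ edges and $d$ the gcd of its vertex degrees, set \[m_1(G)=\mathrm{lcm}\left(\frac{e}{\gcd(e,n(n-1)/2)},\ \frac{d}{\gcd(d,n-1)}\right);\] then $m_1(G)$ divides $\mathrm{pm}(G)$, and the partition index is $\mathrm{pi}(G)=\mathrm{pm}(G)/m_1(G)$. -}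

module Defs where

open import Data.Bool using (Bool; true; false; _∧_; if_then_else_)
open import Data.Nat using (ℕ; zero; suc; _+_; _*_; _∸_; _<ᵇ_; _<_)
open import Data.Nat.DivMod using (_/_)
open import Data.Nat.GCD using (gcd)
open import Data.Nat.LCM using (lcm)
open import Data.Nat.Divisibility using (_∣_)
open import Data.Fin using (Fin; zero; suc; toℕ)
open import Data.List using (List; []; _∷_; map; allFin; foldr)
open import Data.Nat.ListAction using (sum)
open import Data.List.Relation.Unary.All using (All)
open import Data.Product using (Σ; _×_)
open import Function.Bundles using (_↔_; Inverse)
open import Relation.Binary.PropositionalEquality using (_≡_; _≢_)

record Graph (n : ℕ) : Set where
  field
    adj    : Fin n → Fin n → Bool
    sym    : ∀ i j → adj i j ≡ adj j i
    irrefl : ∀ i → adj i i ≡ false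
open Graph public

Iso : {n : ℕ} → Graph n → Graph n → Set
Iso {n} G H = Σ (Fin n ↔ Fin n) λ σ →
  ∀ i j → adj H (Inverse.to σ i) (Inverse.to σ j) ≡ adj G i j

countL : {A : Set} → (A → Bool) → List A → ℕ
countL p []       = 0
countL p (x ∷ xs) = if p x then suc (countL p xs) else countL p xs

-- m K_n can be partitioned into copies of G
Partitionable : {n : ℕ} → Graph n → ℕ → Set
Partitionable {n} G m = Σ (List (Graph n)) λ Gs →
  All (Iso G) Gs ×
  (∀ (i j : Fin n) → i ≢ j → countL (λ H → adj H i j) Gs ≡ m)

InM : {n : ℕ} → Graph n → ℕ → Set
InM G m = 0 < m × Partitionable G m

IsPm : {n : ℕ} → Graph n → ℕ → Set
IsPm G k = (∀ m → InM G m → k ∣ m) ×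
           (∀ d → (∀ m → InM G m → d ∣ m) → d ∣ k)

degree : {n : ℕ} → Graph n → Fin n → ℕ
degree {n} G v = countL (adj G v) (allFin n)

edges : {n : ℕ} → Graph n → ℕ
edges {n} G = sum (map (λ i → countL (λ j → adj G i j ∧ (toℕ i <ᵇ toℕ j)) (allFin n)) (allFin n))

degGcd : {n : ℕ} → Graph n → ℕ
degGcd {n} G = foldr (λ v r → gcd (degree G v) r) 0 (allFin n)

-- division with the convention a ÷ 0 = 0 (only used with nonzero divisors)
divℕ : ℕ → ℕ → ℕ
divℕ a zero    = 0
divℕ a (suc b) = a / suc b

m1 : {n : ℕ} → Graph n → ℕ
m1 {n} G = lcm (divℕ e (gcd e (n * (n ∸ 1) / 2)))
               (divℕ d (gcd d (n ∸ 1)))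
  where
    e = edges G
    d = degGcd G

IsPi : {n : ℕ} → Graph n → ℕ → Set
IsPi G p = Σ ℕ λ k → IsPm G k × k ≡ p * m1 G

starAdj : {n : ℕ} → Fin n → Fin n → Bool
starAdj zero    zero    = false
starAdj zero    (suc _) = true
starAdj (suc _) zero    = true
starAdj (suc _) (suc _) = false

star : (n : ℕ) → Graph n
star n = record { adj = starAdj ; sym = s ; irrefl = r }
  where
    s : ∀ (i j : Fin n) → starAdj i j ≡ starAdj j i
    s zero zero = _≡_.refl
    s zero (suc _) = _≡_.refl
    s (suc _) zero = _≡_.refl
    s (suc _) (suc _) = _≡_.refl
    r : ∀ (i : Fin n) → starAdj i i ≡ false
    r zero = _≡_.refl
    r (suc _) = _≡_.refl

-- A star has no triangle, so any three vertices span 0 or 2 of its edges.  If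
-- mKₙ is partitioned into copies of the star, the multiplicities of the pairs
-- 01, 02, 12 add up to 3m and also to a sum of even numbers, one per copy; so m
-- is even.  Conversely the n stars centred at the n vertices cover every pair
-- {i, j} exactly twice (as the stars centred at i and at j), so 2qKₙ is
-- partitionable.  For pi, the star has n - 1 edges and degree gcd 1, so
-- m₁ = (n - 1) / gcd (n - 1, n(n - 1)/2), which is 1 for even n and 2 for odd n.

module Submission where

open import Defs
open import Data.Nat using (ℕ; _<_)
open import Data.Nat.Divisibility using (_∣_)
open import Data.Product using (_×_)
open import Function.Bundles using (_⇔_)
open import Relation.Nullary using (¬_)

open import Data.Bool using (Bool; true; false; _xor_; _∧_)
open import Data.Empty using (⊥-elim)
open import Data.Fin using (Fin; zero; suc; toℕ)
open import Data.Fin.Properties using (_≟_)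
open import Data.Fin.Permutation using (Permutation′; transpose)
open import Data.List using (List; []; _∷_; _++_; map; foldr; length; allFin; tabulate)
open import Data.List.Properties using (length-tabulate; map-tabulate; map-∘)
open import Data.List.Relation.Unary.All as All using (All; []; _∷_; universal)
open import Data.List.Relation.Unary.All.Properties using (++⁺; map⁺)
open import Data.Nat using (zero; suc; _+_; _*_; _<ᵇ_; z≤n; s≤s)
open import Data.Nat.Divisibility using (divides; ∣-refl; ∣-antisym; _∣0; 1∣_; m∣m*n; n∣m*n; ∣m⇒∣m*n; ∣m∣n⇒∣m+n; ∣m+n∣m⇒∣n)
open import Data.Nat.DivMod using (_/_; m*n/n≡m; n/n≡1)
open import Data.Nat.GCD using (gcd; gcd[m,n]∣m; gcd[m,n]∣n; gcd-greatest; gcd-zeroˡ; gcd-zeroʳ)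
open import Data.Nat.LCM using (lcm; lcm-least; m∣lcm[m,n])
open import Data.Nat.ListAction using (sum)
open import Data.Nat.Properties using (+-comm; +-suc; +-identityʳ; *-identityˡ; *-assoc; *-comm)
open import Data.Nat.Tactic.RingSolver using (solve-∀)
open import Data.Product using (∃; _,_; proj₁; proj₂; map₂)
open import Data.Sum using (_⊎_; inj₁; inj₂)
open import Function using (_∘_; id)
open import Function.Bundles using (Inverse; Equivalence; mk⇔)
open import Relation.Nullary using (does; yes; no)
import Relation.Binary.PropositionalEquality as ≡
open ≡ using (_≡_; _≢_; refl; trans; cong; cong₂; subst)
open ≡.≡-Reasoning

Bool→ℕ : Bool → ℕ
Bool→ℕ false = 0
Bool→ℕ true  = 1

module _ {A : Set} where

  countL-∷ : ∀ (p : A → Bool) x xs → countL p (x ∷ xs) ≡ Bool→ℕ (p x) + countL p xs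
  countL-∷ p x xs with p x
  ... | true  = refl
  ... | false = refl

  countL-cong : ∀ {p q : A → Bool} → (∀ x → p x ≡ q x) → ∀ xs → countL p xs ≡ countL q xs
  countL-cong         p≗q []       = refl
  countL-cong {p} {q} p≗q (x ∷ xs) = begin
    countL p (x ∷ xs)              ≡⟨ countL-∷ p x xs ⟩
    Bool→ℕ (p x) + countL p xs     ≡⟨ cong₂ _+_ (cong Bool→ℕ (p≗q x)) (countL-cong p≗q xs) ⟩
    Bool→ℕ (q x) + countL q xs     ≡⟨ countL-∷ q x xs ⟨
    countL q (x ∷ xs)              ∎

  countL-map : ∀ {B : Set} (p : B → Bool) (f : A → B) xs → countL p (map f xs) ≡ countL (p ∘ f) xs
  countL-map p f []       = refl
  countL-map p f (x ∷ xs) with p (f x)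
  ... | true  = cong suc (countL-map p f xs)
  ... | false = countL-map p f xs

  countL-++ : ∀ (p : A → Bool) xs ys → countL p (xs ++ ys) ≡ countL p xs + countL p ys
  countL-++ p []       ys = refl
  countL-++ p (x ∷ xs) ys with p x
  ... | true  = cong suc (countL-++ p xs ys)
  ... | false = countL-++ p xs ys

  countL-none : ∀ {p : A → Bool} → (∀ x → p x ≡ false) → ∀ xs → countL p xs ≡ 0
  countL-none allFalse []       = refl
  countL-none allFalse (x ∷ xs) rewrite allFalse x = countL-none allFalse xs

  countL-all : ∀ {p : A → Bool} → (∀ x → p x ≡ true) → ∀ xs → countL p xs ≡ length xs
  countL-all allTrue []       = refl
  countL-all allTrue (x ∷ xs) rewrite allTrue x = cong suc (countL-all allTrue xs)

  countL-xor : ∀ {p q : A → Bool} → (∀ x → p x ≡ true → q x ≡ false) →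
               ∀ xs → countL (λ x → p x xor q x) xs ≡ countL p xs + countL q xs
  countL-xor                disjoint []       = refl
  countL-xor {p} {q} disjoint (x ∷ xs) with p x in px | q x in qx
  ... | true  | true  with () ← trans (≡.sym qx) (disjoint x px)
  ... | true  | false = cong suc (countL-xor disjoint xs)
  ... | false | true  = trans (cong suc (countL-xor disjoint xs)) (≡.sym (+-suc _ _))
  ... | false | false = countL-xor disjoint xs

  sum-map-≡0 : ∀ (f : A → ℕ) → (∀ x → f x ≡ 0) → ∀ xs → sum (map f xs) ≡ 0
  sum-map-≡0 f f≡0 []       = refl
  sum-map-≡0 f f≡0 (x ∷ xs) rewrite f≡0 x = sum-map-≡0 f f≡0 xs

countL-allFin-suc : ∀ {n} (p : Fin (suc n) → Bool) →
                    countL p (allFin (suc n)) ≡ Bool→ℕ (p zero) + countL (p ∘ suc) (allFin n)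
countL-allFin-suc {n} p = begin
  countL p (allFin (suc n))                       ≡⟨ cong (countL p ∘ (zero ∷_)) (map-tabulate id suc) ⟨
  countL p (zero ∷ map suc (allFin n))            ≡⟨ countL-∷ p zero (map suc (allFin n)) ⟩
  Bool→ℕ (p zero) + countL p (map suc (allFin n)) ≡⟨ cong (Bool→ℕ (p zero) +_) (countL-map p suc (allFin n)) ⟩
  Bool→ℕ (p zero) + countL (p ∘ suc) (allFin n)   ∎

countL-≟-allFin : ∀ {n} (i : Fin n) → countL (λ c → does (i ≟ c)) (allFin n) ≡ 1
countL-≟-allFin {suc n} zero    = trans (countL-allFin-suc {n} (λ c → does (zero ≟ c)))
                                        (cong suc (countL-none (λ _ → refl) (allFin n)))
countL-≟-allFin {suc n} (suc i) = trans (countL-allFin-suc {n} (λ c → does (suc i ≟ c)))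
                                        (countL-≟-allFin i)

edgesAmong : ∀ {n} → Graph n → Fin n → Fin n → Fin n → ℕ
edgesAmong G a b c = Bool→ℕ (adj G a b) + Bool→ℕ (adj G a c) + Bool→ℕ (adj G b c)

EvenOnTriples : ∀ {n} → Graph n → Set
EvenOnTriples G = ∀ a b c → 2 ∣ edgesAmong G a b c

Iso-adj : ∀ {n} {G H : Graph n} (iso : Iso G H) (x y : Fin n) →
          adj H x y ≡ adj G (Inverse.from (proj₁ iso) x) (Inverse.from (proj₁ iso) y)
Iso-adj {G = G} {H} (σ , preserves) x y = begin
  adj H x y                                           ≡⟨ cong₂ (adj H) (to∘from x) (to∘from y) ⟨
  adj H (to (from x)) (to (from y))                   ≡⟨ preserves (from x) (from y) ⟩
  adj G (from x) (from y)                             ∎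
  where open Inverse σ renaming (strictlyInverseˡ to to∘from)

edgesAmong-Iso : ∀ {n} {G H : Graph n} (iso : Iso G H) (a b c : Fin n) →
  let from = Inverse.from (proj₁ iso) in edgesAmong H a b c ≡ edgesAmong G (from a) (from b) (from c)
edgesAmong-Iso {n} {G} {H} iso a b c =
  cong₂ _+_ (cong₂ _+_ (edge a b) (edge a c)) (edge b c)
  where
  from : Fin n → Fin n
  from = Inverse.from (proj₁ iso)
  edge : ∀ x y → Bool→ℕ (adj H x y) ≡ Bool→ℕ (adj G (from x) (from y))
  edge x y = cong Bool→ℕ (Iso-adj {G = G} {H} iso x y)

EvenOnTriples-Iso : ∀ {n} {G H : Graph n} → Iso G H → EvenOnTriples G → EvenOnTriples H
EvenOnTriples-Iso {G = G} {H} iso even a b c =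
  subst (2 ∣_) (≡.sym (edgesAmong-Iso {G = G} {H} iso a b c)) (even _ _ _)

star-evenOnTriples : ∀ {n} → EvenOnTriples (star n)
star-evenOnTriples zero    zero    zero    = 2 ∣0
star-evenOnTriples zero    zero    (suc _) = ∣-refl
star-evenOnTriples zero    (suc _) zero    = ∣-refl
star-evenOnTriples zero    (suc _) (suc _) = ∣-refl
star-evenOnTriples (suc _) zero    zero    = ∣-refl
star-evenOnTriples (suc _) zero    (suc _) = ∣-refl
star-evenOnTriples (suc _) (suc _) zero    = ∣-refl
star-evenOnTriples (suc _) (suc _) (suc _) = 2 ∣0

+-interchange₃ : ∀ x y z u v w → (x + u) + (y + v) + (z + w) ≡ (x + y + z) + (u + v + w)
+-interchange₃ = solve-∀

countL-edgesAmong-even : ∀ {n} (a b c : Fin n) {Gs : List (Graph n)} → All EvenOnTriples Gs →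
  2 ∣ countL (λ H → adj H a b) Gs + countL (λ H → adj H a c) Gs + countL (λ H → adj H b c) Gs
countL-edgesAmong-even a b c []                    = 2 ∣0
countL-edgesAmong-even a b c {H ∷ Hs} (even ∷ evens)
  rewrite countL-∷ (λ H → adj H a b) H Hs | countL-∷ (λ H → adj H a c) H Hs | countL-∷ (λ H → adj H b c) H Hs
        | +-interchange₃ (Bool→ℕ (adj H a b)) (Bool→ℕ (adj H a c)) (Bool→ℕ (adj H b c))
                         (countL (λ H → adj H a b) Hs) (countL (λ H → adj H a c) Hs) (countL (λ H → adj H b c) Hs)
  = ∣m∣n⇒∣m+n (even a b c) (countL-edgesAmong-even a b c evens)

2∣m+m+m⇒2∣m : ∀ m → 2 ∣ m + m + m → 2 ∣ m
2∣m+m+m⇒2∣m m 2∣3m = ∣m+n∣m⇒∣n 2∣3m (divides m (m+m≡m*2 m))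
  where
  m+m≡m*2 : ∀ m → m + m ≡ m * 2
  m+m≡m*2 = solve-∀

Partitionable⇒even : ∀ {k m} {G : Graph (3 + k)} → EvenOnTriples G → Partitionable G m → 2 ∣ m
Partitionable⇒even {k} {m} {G} even (Gs , copies , counts) =
  2∣m+m+m⇒2∣m m (subst (2 ∣_) multiplicities≡m evenTotal)
  where
  0F 1F 2F : Fin (3 + k)
  0F = zero
  1F = suc zero
  2F = suc (suc zero)
  multiplicities : ℕ
  multiplicities = countL (λ H → adj H 0F 1F) Gs + countL (λ H → adj H 0F 2F) Gs + countL (λ H → adj H 1F 2F) Gs
  evenTotal : 2 ∣ multiplicities
  evenTotal = countL-edgesAmong-even 0F 1F 2F (All.map (λ {H} iso → EvenOnTriples-Iso {G = G} {H} iso even) copies)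
  multiplicities≡m : multiplicities ≡ m + m + m
  multiplicities≡m = cong₂ _+_ (cong₂ _+_ (counts 0F 1F (λ ())) (counts 0F 2F (λ ()))) (counts 1F 2F (λ ()))

relabel : ∀ {n} → Permutation′ n → Graph n → Graph n
relabel σ G = record
  { adj    = λ i j → adj G (from i) (from j)
  ; sym    = λ i j → sym G (from i) (from j)
  ; irrefl = λ i → irrefl G (from i)
  }
  where open Inverse σ using (from)

Iso-relabel : ∀ {n} (σ : Permutation′ n) (G : Graph n) → Iso G (relabel σ G)
Iso-relabel σ G = σ , λ i j → cong₂ (adj G) (from∘to i) (from∘to j)
  where open Inverse σ renaming (strictlyInverseʳ to from∘to)

starAt : ∀ {n} → Fin (suc n) → Graph (suc n)
starAt c = relabel (transpose zero c) (star _)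

isZero : ∀ {n} → Fin n → Bool
isZero zero    = true
isZero (suc _) = false

starAdj-isZero : ∀ {n} (i j : Fin n) → starAdj i j ≡ isZero i xor isZero j
starAdj-isZero zero    zero    = refl
starAdj-isZero zero    (suc _) = refl
starAdj-isZero (suc _) zero    = refl
starAdj-isZero (suc _) (suc _) = refl

module _ {n} (σ : Permutation′ (suc n)) where
  open Inverse σ

  isZero-from : ∀ i → isZero (from i) ≡ does (i ≟ to zero)
  isZero-from i with i ≟ to zero
  ... | yes refl = cong isZero (strictlyInverseʳ zero)
  ... | no i≢to0 with from i in from-i
  ...   | zero  = ⊥-elim (i≢to0 (trans (≡.sym (strictlyInverseˡ i)) (cong to from-i)))
  ...   | suc _ = refl

adj-starAt : ∀ {n} (c i j : Fin (suc n)) → adj (starAt c) i j ≡ does (i ≟ c) xor does (j ≟ c)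
adj-starAt c i j = trans (starAdj-isZero _ _)
  (cong₂ _xor_ (isZero-from (transpose zero c) i) (isZero-from (transpose zero c) j))

countL-starAt : ∀ {n} {i j : Fin (suc n)} → i ≢ j → countL (λ c → adj (starAt c) i j) (allFin (suc n)) ≡ 2
countL-starAt {n} {i} {j} i≢j = begin
  countL (λ c → adj (starAt c) i j) (allFin (suc n))
    ≡⟨ countL-cong (λ c → adj-starAt c i j) (allFin (suc n)) ⟩
  countL (λ c → does (i ≟ c) xor does (j ≟ c)) (allFin (suc n))
    ≡⟨ countL-xor disjoint (allFin (suc n)) ⟩
  countL (λ c → does (i ≟ c)) (allFin (suc n)) + countL (λ c → does (j ≟ c)) (allFin (suc n))
    ≡⟨ cong₂ _+_ (countL-≟-allFin i) (countL-≟-allFin j) ⟩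
  2 ∎
  where
  disjoint : ∀ c → does (i ≟ c) ≡ true → does (j ≟ c) ≡ false
  disjoint c i≡c with i ≟ c | j ≟ c
  ... | yes refl | yes refl = ⊥-elim (i≢j refl)
  ... | yes _    | no _     = refl
  disjoint c () | no _ | _

Partitionable-0 : ∀ {n} {G : Graph n} → Partitionable G 0
Partitionable-0 = [] , [] , λ _ _ _ → refl

Partitionable-+ : ∀ {n} {G : Graph n} {m m′} → Partitionable G m → Partitionable G m′ → Partitionable G (m + m′)
Partitionable-+ (Gs , copies , counts) (Gs′ , copies′ , counts′) =
  Gs ++ Gs′ , ++⁺ copies copies′ , λ i j i≢j →
    trans (countL-++ (λ H → adj H i j) Gs Gs′) (cong₂ _+_ (counts i j i≢j) (counts′ i j i≢j))

Partitionable-* : ∀ {n} {G : Graph n} {m} q → Partitionable G m → Partitionable G (q * m)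
Partitionable-* {G = G} zero    _ = Partitionable-0 {G = G}
Partitionable-* {G = G} (suc q) P = Partitionable-+ {G = G} P (Partitionable-* {G = G} q P)

star-Partitionable-2 : ∀ n → Partitionable (star (suc n)) 2
star-Partitionable-2 n =
  map starAt (allFin (suc n)) ,
  map⁺ (universal (λ c → Iso-relabel (transpose zero c) (star (suc n))) (allFin (suc n))) ,
  λ i j i≢j → trans (countL-map (λ H → adj H i j) starAt (allFin (suc n))) (countL-starAt i≢j)

star-Partitionable⇔even : ∀ k m → Partitionable (star (3 + k)) m ⇔ 2 ∣ m
star-Partitionable⇔even k m = mk⇔ (Partitionable⇒even {G = star (3 + k)} star-evenOnTriples) λ where
  (divides q refl) → Partitionable-* {G = star (3 + k)} q (star-Partitionable-2 (2 + k))

IsPm-multiples : ∀ {n} {G : Graph n} {k} → 0 < k → (∀ m → InM G m ⇔ (0 < m × k ∣ m)) → IsPm G k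
IsPm-multiples k>0 M≡kℕ =
  (λ m → proj₂ ∘ Equivalence.to (M≡kℕ m)) ,
  (λ d d∣M → d∣M _ (Equivalence.from (M≡kℕ _) (k>0 , ∣-refl)))

InM-star : ∀ k m → InM (star (3 + k)) m ⇔ (0 < m × 2 ∣ m)
InM-star k m = mk⇔ (map₂ to) (map₂ from)
  where open Equivalence (star-Partitionable⇔even k m)

edges-star : ∀ k → edges (star (suc k)) ≡ k
edges-star k = begin
  sum (map row (allFin (suc k)))                  ≡⟨ cong (sum ∘ map row ∘ (zero ∷_)) (map-tabulate id suc) ⟨
  centreRow + sum (map row (map suc (allFin k)))  ≡⟨ cong (λ rows → centreRow + sum rows) (map-∘ (allFin k)) ⟨
  centreRow + sum (map leafRow (allFin k)) ≡⟨ cong₂ _+_ centreRow≡k (sum-map-≡0 leafRow leafRow≡0 (allFin k)) ⟩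
  k + 0                                    ≡⟨ +-identityʳ k ⟩
  k                                        ∎
  where
  edgeUp : Fin (suc k) → Fin (suc k) → Bool
  edgeUp i j = adj (star (suc k)) i j ∧ (toℕ i <ᵇ toℕ j)
  row : Fin (suc k) → ℕ
  row i = countL (edgeUp i) (allFin (suc k))
  centreRow : ℕ
  centreRow = row zero
  leafRow : Fin k → ℕ
  leafRow = row ∘ suc
  centreRow≡k : centreRow ≡ k
  centreRow≡k = begin
    centreRow                       ≡⟨ countL-allFin-suc (edgeUp zero) ⟩
    countL (λ _ → true) (allFin k)  ≡⟨ countL-all (λ _ → refl) (allFin k) ⟩
    length (allFin k)               ≡⟨ length-tabulate id ⟩
    k                               ∎
  leafRow≡0 : ∀ i → leafRow i ≡ 0
  leafRow≡0 i = countL-none {p = edgeUp (suc i)} (λ { zero → refl ; (suc _) → refl }) (allFin (suc k))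

degree-star-leaf : ∀ k (i : Fin k) → degree (star (suc k)) (suc i) ≡ 1
degree-star-leaf k i = trans (countL-allFin-suc (adj (star (suc k)) (suc i)))
                             (cong suc (countL-none (λ _ → refl) (allFin k)))

degGcd-star : ∀ k → degGcd (star (2 + k)) ≡ 1
degGcd-star k = begin
  gcd (degree S zero) (gcd (degree S 1F) rest) ≡⟨ cong (λ d → gcd (degree S zero) (gcd d rest)) (degree-star-leaf (suc k) zero) ⟩
  gcd (degree S zero) (gcd 1 rest)             ≡⟨ cong (gcd (degree S zero)) (gcd-zeroˡ rest) ⟩
  gcd (degree S zero) 1                        ≡⟨ gcd-zeroʳ (degree S zero) ⟩
  1                                            ∎
  where
  S : Graph (2 + k)
  S = star (2 + k)
  1F : Fin (2 + k)
  1F = suc zero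
  rest : ℕ
  rest = foldr (λ v r → gcd (degree S v) r) 0 (tabulate {n = k} (λ i → suc (suc i)))

lcm[n,1]≡n : ∀ n → lcm n 1 ≡ n
lcm[n,1]≡n n = ∣-antisym (lcm-least ∣-refl (1∣ n)) (m∣lcm[m,n] n 1)

-- The edge term of m₁ for a graph with e edges on n = e + 1 vertices.
edgeFactor : ℕ → ℕ
edgeFactor e = divℕ e (gcd e (suc e * e / 2))

m1-star : ∀ k → m1 (star (2 + k)) ≡ edgeFactor (suc k)
m1-star k = begin
  m1 (star (2 + k))
    ≡⟨ cong₂ (λ e d → lcm (divℕ e (gcd e ((2 + k) * suc k / 2))) (divℕ d (gcd d (suc k))))
             (edges-star (suc k)) (degGcd-star k) ⟩
  lcm (edgeFactor (suc k)) (divℕ 1 (gcd 1 (suc k)))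
    ≡⟨ cong (λ g → lcm (edgeFactor (suc k)) (divℕ 1 g)) (gcd-zeroˡ (suc k)) ⟩
  lcm (edgeFactor (suc k)) 1
    ≡⟨ lcm[n,1]≡n (edgeFactor (suc k)) ⟩
  edgeFactor (suc k) ∎

gcd[n,m*n]≡n : ∀ n m → gcd n (m * n) ≡ n
gcd[n,m*n]≡n n m = ∣-antisym (gcd[m,n]∣m n (m * n)) (gcd-greatest ∣-refl (n∣m*n m))

gcd[2h,[1+2h]h]≡h : ∀ h → gcd (h * 2) (suc (h * 2) * h) ≡ h
gcd[2h,[1+2h]h]≡h h = ∣-antisym g∣h (gcd-greatest (m∣m*n 2) (n∣m*n (suc (h * 2))))
  where
  g : ℕ
  g = gcd (h * 2) (suc (h * 2) * h)
  g∣h : g ∣ h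
  g∣h = ∣m+n∣m⇒∣n {m = h * 2 * h} (subst (g ∣_) (+-comm h (h * 2 * h)) (gcd[m,n]∣n (h * 2) (suc (h * 2) * h)))
                                  (∣m⇒∣m*n h (gcd[m,n]∣m (h * 2) (suc (h * 2) * h)))

edgeFactor-oddEdges : ∀ e → 2 ∣ suc (suc e) → edgeFactor (suc e) ≡ 1
edgeFactor-oddEdges e (divides q n≡2q) = begin
  divℕ E (gcd E (suc E * E / 2)) ≡⟨ cong (λ x → divℕ E (gcd E x)) pairs≡qE ⟩
  divℕ E (gcd E (q * E))         ≡⟨ cong (divℕ E) (gcd[n,m*n]≡n E q) ⟩
  E / E                          ≡⟨ n/n≡1 E ⟩
  1                              ∎
  where
  E : ℕ
  E = suc e
  q*2*E≡q*E*2 : ∀ q E → q * 2 * E ≡ q * E * 2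
  q*2*E≡q*E*2 = solve-∀
  pairs≡qE : suc E * E / 2 ≡ q * E
  pairs≡qE = begin
    suc E * E / 2 ≡⟨ cong (λ n → n * E / 2) n≡2q ⟩
    q * 2 * E / 2 ≡⟨ cong (_/ 2) (q*2*E≡q*E*2 q E) ⟩
    q * E * 2 / 2 ≡⟨ m*n/n≡m (q * E) 2 ⟩
    q * E         ∎

edgeFactor-evenEdges : ∀ e → 2 ∣ suc e → edgeFactor (suc e) ≡ 2
edgeFactor-evenEdges e (divides zero ())
edgeFactor-evenEdges _ (divides (suc h) refl) = begin
  divℕ E (gcd E (suc E * E / 2)) ≡⟨ cong (λ x → divℕ E (gcd E x)) pairs≡[1+E]h ⟩
  divℕ E (gcd E (suc E * suc h)) ≡⟨ cong (divℕ E) (gcd[2h,[1+2h]h]≡h (suc h)) ⟩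
  suc h * 2 / suc h              ≡⟨ cong (_/ suc h) (*-comm (suc h) 2) ⟩
  2 * suc h / suc h              ≡⟨ m*n/n≡m 2 (suc h) ⟩
  2                              ∎
  where
  E : ℕ
  E = suc h * 2
  pairs≡[1+E]h : suc E * E / 2 ≡ suc E * suc h
  pairs≡[1+E]h = trans (cong (_/ 2) (≡.sym (*-assoc (suc E) (suc h) 2))) (m*n/n≡m (suc E * suc h) 2)

even⊎odd : ∀ n → (∃ λ q → n ≡ q * 2) ⊎ (∃ λ h → n ≡ suc (h * 2))
even⊎odd zero    = inj₁ (0 , refl)
even⊎odd (suc n) with even⊎odd n
... | inj₁ (q , n≡2q)   = inj₂ (q , cong suc n≡2q)
... | inj₂ (h , n≡2h+1) = inj₁ (suc h , cong suc n≡2h+1)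

¬2∣[1+n]⇒2∣n : ∀ n → ¬ 2 ∣ suc n → 2 ∣ n
¬2∣[1+n]⇒2∣n n 2∤1+n with even⊎odd n
... | inj₁ (q , n≡2q)   = divides q n≡2q
... | inj₂ (h , n≡2h+1) = ⊥-elim (2∤1+n (divides (suc h) (cong suc n≡2h+1)))

m1-star-even : ∀ k → 2 ∣ 3 + k → m1 (star (3 + k)) ≡ 1
m1-star-even k 2∣n = trans (m1-star (suc k)) (edgeFactor-oddEdges (suc k) 2∣n)

m1-star-odd : ∀ k → ¬ 2 ∣ 3 + k → m1 (star (3 + k)) ≡ 2
m1-star-odd k 2∤n = trans (m1-star (suc k)) (edgeFactor-evenEdges (suc k) (¬2∣[1+n]⇒2∣n (2 + k) 2∤n))

proposition5 : (n : ℕ) → 2 < n →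
    (∀ m → InM (star n) m ⇔ (0 < m × 2 ∣ m)) ×
    IsPm (star n) 2 ×
    (¬ (2 ∣ n) → IsPi (star n) 1) ×
    (2 ∣ n → IsPi (star n) 2)
proposition5 (suc (suc (suc k))) (s≤s (s≤s (s≤s _))) =
  InM-star k , pm ,
  (λ 2∤n → 2 , pm , ≡.sym (trans (*-identityˡ _) (m1-star-odd k 2∤n))) ,
  (λ 2∣n → 2 , pm , cong (2 *_) (≡.sym (m1-star-even k 2∣n)))
  where
  pm : IsPm (star (3 + k)) 2
  pm = IsPm-multiples {G = star (3 + k)} (s≤s z≤n) (InM-star k)
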